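{- Let $k\in\mathbb{N}$ and $S=\langle 4k+7,4k+9,4k+13,4k+15\rangle$. Then (1) $\mathrm{PF}(S)=\{4k+11,\ 4k^2+19k+17,\ 4k^2+19k+19\}$; (2) $\mathrm{F}(S)=4k^2+19k+19$; (3) $\mathrm{g}(S)=2k^2+10k+12$; (4) $\mathrm{t}(S)=3$.
   Context: $\mathbb{N}=\{0,1,2,\dots\}$. For $X\subseteq\mathbb{N}$, $\langle X\rangle$ is the submonoid of $(\mathbb{N},+)$ generated by $X$; here it is a numerical semigroup. $\mathrm{F}(S)$ is the largest integer not in $S$, $\mathrm{g}(S)=|\mathbb{N}\setminus S|$, $\mathrm{PF}(S)$ is the set of integers $x\notin S$ with $x+s\in S$ for all $s\in S\setminus\{0\}$, and $\mathrm{t}(S)=|\mathrm{PF}(S)|$. -}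

module Defs where

open import Data.Nat using (ℕ; zero; suc; _+_; _<_)
open import Data.List using (List; length)
open import Data.List.Membership.Propositional using (_∈_)
open import Data.List.Relation.Unary.Unique.Propositional using (Unique)
open import Data.Product using (Σ; _×_)
open import Function.Bundles using (_⇔_)
open import Relation.Nullary using (¬_)
open import Relation.Binary.PropositionalEquality using (_≡_; _≢_)

Subset : Set₁
Subset = ℕ → Set

data ⟨_⟩ (X : List ℕ) : ℕ → Set where
  zero∈ : ⟨ X ⟩ 0
  gen+  : ∀ {g y} → g ∈ X → ⟨ X ⟩ y → ⟨ X ⟩ (g + y)

IsFrobenius : Subset → ℕ → Set
IsFrobenius S f = ¬ S f × (∀ y → f < y → S y)

IsGenus : Subset → ℕ → Set
IsGenus S g = Σ (List ℕ) λ L → Unique L × (∀ x → (x ∈ L) ⇔ (¬ S x)) × (length L ≡ g)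

PF : Subset → ℕ → Set
PF S x = ¬ S x × (∀ s → S s → s ≢ 0 → S (x + s))

IsType : Subset → ℕ → Set
IsType S t = Σ (List ℕ) λ L → Unique L × (∀ x → (x ∈ L) ⇔ PF S x) × (length L ≡ t)

module Submission where

-- Write a = 4k + 7 and view the generators as a + 2d with d ∈ {0, 1, 3, 4}.  A sum of i
-- generators is i·a + 2t with t ≤ 4i, and every such (i, t) except (1, 2) occurs.  As a is
-- odd, every number is either odd and below a or of the form i·a + 2t with t < a, and the
-- latter form is unique.  Hence the gaps are the odd numbers below a, a + 4, and the numbers
-- i·a + 2t with 4i < t < a, which fill the rows i = 0, …, k + 1 of lengths 4(k + 1 − i) + 2.
-- Counting them gives the genus, and the last entry of the last row is the Frobenius number.
-- A gap x can only be pseudo-Frobenius if neither x + a nor x + (a + 8) is a gap of the next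
-- row; this leaves a + 4 and the last two entries of the last row.

open import Defs
open import Data.Nat
open import Data.Nat.Properties
open import Data.Nat.DivMod using (_%_; _/_; m≡m%n+[m/n]*n; m%n<n; m<n⇒m%n≡m; [m+kn]%n≡m%n)
open import Data.Nat.Tactic.RingSolver using (solve)
open import Data.List using (List; []; _∷_; _++_; length; map; applyUpTo)
open import Data.List.Properties using (length-++; length-applyUpTo)
open import Data.List.Membership.Propositional using (_∈_)
open import Data.List.Membership.Propositional.Properties
  using (∈-map⁺; ∈-map⁻; ∈-applyUpTo⁺; ∈-applyUpTo⁻; ∈-++⁺ˡ; ∈-++⁺ʳ; ∈-++⁻)
open import Data.List.Relation.Unary.Any using (here; there)
import Data.List.Relation.Unary.All as All
open import Data.List.Relation.Unary.All.Properties using (¬Any⇒All¬)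
import Data.List.Relation.Unary.AllPairs as AllPairs
open import Data.List.Relation.Unary.Unique.Propositional using (Unique)
open import Data.List.Relation.Unary.Unique.Propositional.Properties using (++⁺; applyUpTo⁺₁)
open import Data.Product using (Σ; ∃₂; _×_; _,_; proj₁)
open import Data.Sum using (_⊎_; inj₁; inj₂)
open import Data.Empty using (⊥-elim)
open import Function.Bundles using (_⇔_; mk⇔; Equivalence)
import Function.Properties.Equivalence as ⇔
open import Relation.Nullary using (¬_; yes; no)
open import Relation.Nullary.Decidable using (_×-dec_)
open import Relation.Binary.PropositionalEquality

≤-offset : ∀ {m n} k → m + k ≡ n → m ≤ n
≤-offset k refl = m≤m+n _ k

+≡+⇒≤ : ∀ {p q p′ q′} → p + q ≡ p′ + q′ → p′ ≤ p → q ≤ q′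
+≡+⇒≤ {p} {q} {p′} eq p′≤p = +-cancelˡ-≤ p′ _ _ (≤-trans (+-monoˡ-≤ q p′≤p) (≤-reflexive eq))

even-or-odd : ∀ n → Σ ℕ λ h → n ≡ 2 * h ⊎ n ≡ suc (2 * h)
even-or-odd zero = 0 , inj₁ refl
even-or-odd (suc n) with even-or-odd n
... | h , inj₁ refl = h , inj₂ refl
... | h , inj₂ refl = suc h , inj₁ (sym (+-suc (suc h) (h + 0)))

data Odd : ℕ → Set where
  odd : ∀ m → Odd (suc (2 * m))

division-unique : ∀ n .{{_ : NonZero n}} {i j r s} → r < n → s < n → n * i + r ≡ n * j + s → i ≡ j × r ≡ s
division-unique n {i} {j} {r} {s} r<n s<n eq = i≡j , r≡s
  where
  open ≡-Reasoning
  r≡s : r ≡ s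
  r≡s = begin
    r                ≡⟨ sym (m<n⇒m%n≡m r<n) ⟩
    r % n            ≡⟨ sym ([m+kn]%n≡m%n r i n) ⟩
    (r + i * n) % n  ≡⟨ cong (_% n) (trans (swap r i) (trans eq (sym (swap s j)))) ⟩
    (s + j * n) % n  ≡⟨ [m+kn]%n≡m%n s j n ⟩
    s % n            ≡⟨ m<n⇒m%n≡m s<n ⟩
    s                ∎
    where
    swap : ∀ x y → x + y * n ≡ n * y + x
    swap x y = solve (x ∷ y ∷ n ∷ [])
  i≡j : i ≡ j
  i≡j = *-cancelˡ-≡ i j n (+-cancelʳ-≡ r _ _ (trans eq (cong (n * j +_) (sym r≡s))))

∈-triple⇔ : ∀ {v x y z : ℕ} → v ∈ x ∷ y ∷ z ∷ [] ⇔ (v ≡ x ⊎ v ≡ y ⊎ v ≡ z)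
∈-triple⇔ = mk⇔ to from
  where
  to : ∀ {v x y z : ℕ} → v ∈ x ∷ y ∷ z ∷ [] → v ≡ x ⊎ v ≡ y ⊎ v ≡ z
  to (here eq)                 = inj₁ eq
  to (there (here eq))         = inj₂ (inj₁ eq)
  to (there (there (here eq))) = inj₂ (inj₂ eq)
  from : ∀ {v x y z : ℕ} → v ≡ x ⊎ v ≡ y ⊎ v ≡ z → v ∈ x ∷ y ∷ z ∷ []
  from (inj₁ eq)        = here eq
  from (inj₂ (inj₁ eq)) = there (here eq)
  from (inj₂ (inj₂ eq)) = there (there (here eq))

large-gap⇒PF : ∀ {S : Subset} {f a x} → IsFrobenius S f → (∀ s → S s → s ≢ 0 → a ≤ s) →
  f < x + a → ¬ S x → PF S x
large-gap⇒PF (_ , above-f) a≤ f<x+a x∉ =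
  x∉ , λ s s∈ s≢0 → above-f _ (<-≤-trans f<x+a (+-monoʳ-≤ _ (a≤ s s∈ s≢0)))

-- Sums of the generators a, a + 2, a + 6, a + 8

⟨⟩-+ : ∀ {X x y} → ⟨ X ⟩ x → ⟨ X ⟩ y → ⟨ X ⟩ (x + y)
⟨⟩-+ zero∈ y∈ = y∈
⟨⟩-+ {y = y} (gen+ {g} {x} g∈ x∈) y∈ = subst ⟨ _ ⟩ (sym (+-assoc g x y)) (gen+ g∈ (⟨⟩-+ x∈ y∈))

offsets : List ℕ
offsets = 0 ∷ 1 ∷ 3 ∷ 4 ∷ []

generators : ℕ → List ℕ
generators a = map (λ d → a + 2 * d) offsets

S : ℕ → Subset
S a = ⟨ generators a ⟩

offset≤4 : ∀ {d} → d ∈ offsets → d ≤ 4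
offset≤4 (here refl)                         = z≤n
offset≤4 (there (here refl))                 = s≤s z≤n
offset≤4 (there (there (here refl)))         = s≤s (s≤s (s≤s z≤n))
offset≤4 (there (there (there (here refl)))) = ≤-refl

offset≢2 : ∀ {d} → d ∈ offsets → d ≢ 2
offset≢2 (here refl)                         = λ ()
offset≢2 (there (here refl))                 = λ ()
offset≢2 (there (there (here refl)))         = λ ()
offset≢2 (there (there (there (here refl)))) = λ ()

generator∈S : ∀ {a d} → d ∈ offsets → S a (a + 2 * d)
generator∈S {a} {d} d∈ = subst (S a) (+-identityʳ _) (gen+ (∈-map⁺ (λ d → a + 2 * d) d∈) zero∈)

∈S⇒a≤ : ∀ {a s} → S a s → s ≢ 0 → a ≤ s
∈S⇒a≤ zero∈ s≢0 = ⊥-elim (s≢0 refl)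
∈S⇒a≤ {a} (gen+ {y = y} g∈ _) _ with d , _ , refl ← ∈-map⁻ (λ d → a + 2 * d) {xs = offsets} g∈ =
  ≤-offset (2 * d + y) (sym (+-assoc a (2 * d) y))

Admissible : ℕ → ℕ → Set
Admissible i t = t ≤ 4 * i × ¬ (i ≡ 1 × t ≡ 2)

generator+ : ∀ a i t d → a + 2 * d + (i * a + 2 * t) ≡ suc i * a + 2 * (d + t)
generator+ a i t d = solve (a ∷ i ∷ t ∷ d ∷ [])

add-generator : ∀ {a} i t d → d ∈ offsets → S a (i * a + 2 * t) → S a (suc i * a + 2 * (d + t))
add-generator {a} i t d d∈ s = subst (S a) (generator+ a i t d) (gen+ (∈-map⁺ (λ d → a + 2 * d) d∈) s)

split-offset : ∀ i t → t ≤ 4 * suc (suc i) →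
  Σ ℕ λ d → Σ ℕ λ t′ → d ∈ offsets × t ≡ d + t′ × Admissible (suc i) t′
split-offset i 0 _ = 0 , 0 , here refl , refl , z≤n , λ { (_ , ()) }
split-offset i 1 _ = 1 , 0 , there (here refl) , refl , z≤n , λ { (_ , ()) }
split-offset i 2 _ = 1 , 1 , there (here refl) , refl , s≤s z≤n , λ { (_ , ()) }
split-offset i 3 _ = 3 , 0 , there (there (here refl)) , refl , z≤n , λ { (_ , ()) }
split-offset 0 4 _ = 4 , 0 , there (there (there (here refl))) , refl , z≤n , λ { (_ , ()) }
split-offset 0 5 _ = 4 , 1 , there (there (there (here refl))) , refl , s≤s z≤n , λ { (_ , ()) }
split-offset 0 6 _ = 3 , 3 , there (there (here refl)) , refl , ≤ᵇ⇒≤ 3 4 _ , λ { (_ , ()) }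
split-offset 0 7 _ = 4 , 3 , there (there (there (here refl))) , refl , ≤ᵇ⇒≤ 3 4 _ , λ { (_ , ()) }
split-offset 0 8 _ = 4 , 4 , there (there (there (here refl))) , refl , ≤-refl , λ { (_ , ()) }
split-offset 0 (suc (suc (suc (suc (suc (suc (suc (suc (suc _))))))))) t≤8 =
  ⊥-elim (<-irrefl refl (≤-trans (m≤m+n 9 _) t≤8))
split-offset (suc i) (suc (suc (suc (suc t)))) t+4≤ =
  4 , t , there (there (there (here refl))) , refl , t≤ , λ { (() , _) }
  where
  t≤ : t ≤ 4 * suc (suc i)
  t≤ = +-cancelˡ-≤ 4 t (4 * suc (suc i)) (subst (4 + t ≤_) (*-suc 4 (suc (suc i))) t+4≤)

admissible⇒∈S : ∀ {a} i t → Admissible i t → S a (i * a + 2 * t)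
admissible⇒∈S 0 0 _ = zero∈
admissible⇒∈S 0 (suc t) (() , _)
admissible⇒∈S 1 0 _ = add-generator 0 0 0 (here refl) zero∈
admissible⇒∈S 1 1 _ = add-generator 0 0 1 (there (here refl)) zero∈
admissible⇒∈S 1 2 (_ , not-1,2) = ⊥-elim (not-1,2 (refl , refl))
admissible⇒∈S 1 3 _ = add-generator 0 0 3 (there (there (here refl))) zero∈
admissible⇒∈S 1 4 _ = add-generator 0 0 4 (there (there (there (here refl)))) zero∈
admissible⇒∈S 1 (suc (suc (suc (suc (suc t))))) (t≤4 , _) =
  ⊥-elim (<-irrefl refl (≤-trans (m≤m+n 5 t) t≤4))
admissible⇒∈S {a} (suc i′@(suc i)) t (t≤ , _) =
  let d , t′ , d∈ , t≡d+t′ , adm = split-offset i t t≤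
  in subst (λ t → S a (suc i′ * a + 2 * t)) (sym t≡d+t′) (add-generator i′ t′ d d∈ (admissible⇒∈S i′ t′ adm))

one-generator-admissible : ∀ {i t d} → d ∈ offsets → t ≤ 4 * i → ¬ (suc i ≡ 1 × d + t ≡ 2)
one-generator-admissible {zero} {zero} {d} d∈ _ (_ , d+0≡2) = offset≢2 d∈ (trans (sym (+-identityʳ d)) d+0≡2)
one-generator-admissible {suc i} _ _ (() , _)

add-offset-admissible : ∀ {i t d} → d ∈ offsets → Admissible i t → Admissible (suc i) (d + t)
add-offset-admissible {i} {t} {d} d∈ (t≤ , _) =
  subst (d + t ≤_) (sym (*-suc 4 i)) (+-mono-≤ (offset≤4 d∈) t≤) , one-generator-admissible d∈ t≤

∈S⇒admissible : ∀ {a x} → S a x → ∃₂ λ i t → Admissible i t × x ≡ i * a + 2 * t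
∈S⇒admissible zero∈ = 0 , 0 , (z≤n , λ { (() , _) }) , refl
∈S⇒admissible {a} (gen+ g∈ s) with ∈-map⁻ (λ d → a + 2 * d) {xs = offsets} g∈ | ∈S⇒admissible s
... | d , d∈ , refl | i , t , adm , refl = suc i , d + t , add-offset-admissible {i} {t} d∈ adm , generator+ a i t d

a+4+∈S : ∀ {a s} → S a s → s ≢ 0 → S a (a + 4 + s)
a+4+∈S zero∈ s≢0 = ⊥-elim (s≢0 refl)
a+4+∈S {a} (gen+ {y = y} g∈ y∈) _ with d , d∈ , refl ← ∈-map⁻ (λ d → a + 2 * d) {xs = offsets} g∈ =
  subst (S a) regroup (⟨⟩-+ (admissible⇒∈S 2 (2 + d) (2+d≤8 , λ { (() , _) })) y∈)
  where
  2+d≤8 : 2 + d ≤ 4 * 2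
  2+d≤8 = ≤-trans (+-monoʳ-≤ 2 (offset≤4 d∈)) (≤ᵇ⇒≤ 6 8 _)
  regroup : 2 * a + 2 * (2 + d) + y ≡ a + 4 + (a + 2 * d + y)
  regroup = solve (a ∷ d ∷ y ∷ [])

PF⇒+generator : ∀ {a x} → 0 < a → PF (S a) x → ∀ {d} → d ∈ offsets → S a (x + (a + 2 * d))
PF⇒+generator {a} 0<a (_ , closed) d∈ = closed _ (generator∈S d∈) (m<n⇒n≢0 (≤-trans 0<a (m≤m+n a _)))

-- Gaps for odd a

twice-below-odd : ∀ m t t′ d → t < suc (2 * m) → 2 * t ≢ suc d * suc (2 * m) + 2 * t′
twice-below-odd m t t′ zero _ eq = even≢odd t (m + t′) (trans eq (solve (m ∷ t′ ∷ [])))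
twice-below-odd m t t′ (suc d) t<a eq =
  <⇒≱ (*-monoʳ-< 2 t<a) (≤-offset (d * suc (2 * m) + 2 * t′) (trans regroup (sym eq)))
  where
  regroup : 2 * suc (2 * m) + (d * suc (2 * m) + 2 * t′) ≡ suc (suc d) * suc (2 * m) + 2 * t′
  regroup = solve (m ∷ d ∷ t′ ∷ [])

coefficient-bound : ∀ {a} → Odd a → ∀ i t i′ t′ → t < a → i * a + 2 * t ≡ i′ * a + 2 * t′ → i′ ≤ i
coefficient-bound _ i t i′ t′ t<a eq with i′ ≤? i
... | yes i′≤i = i′≤i
coefficient-bound (odd m) i t i′ t′ t<a eq | no i′≰i with d , refl ← m≤n⇒∃[o]m+o≡n (≰⇒> i′≰i) =
  ⊥-elim (twice-below-odd m t t′ d t<a (+-cancelˡ-≡ (i * suc (2 * m)) _ _ (trans eq regroup)))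
  where
  regroup : (suc i + d) * suc (2 * m) + 2 * t′ ≡ i * suc (2 * m) + (suc d * suc (2 * m) + 2 * t′)
  regroup = solve (m ∷ i ∷ d ∷ t′ ∷ [])

canonical-unique : ∀ {a} → Odd a → ∀ {i t i′ t′} → t < a → t′ < a →
  i * a + 2 * t ≡ i′ * a + 2 * t′ → i ≡ i′ × t ≡ t′
canonical-unique {a} a-odd {i} {t} {i′} {t′} t<a t′<a eq = i≡i′ , t≡t′
  where
  i≡i′ : i ≡ i′
  i≡i′ = ≤-antisym (coefficient-bound a-odd i′ t′ i t t′<a (sym eq)) (coefficient-bound a-odd i t i′ t′ t<a eq)
  t≡t′ : t ≡ t′
  t≡t′ = *-cancelˡ-≡ t t′ 2 (+-cancelˡ-≡ (i * a) _ _ (trans eq (cong (λ j → j * a + 2 * t′) (sym i≡i′))))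

data Gap (a : ℕ) : ℕ → Set where
  odd-below    : ∀ h → suc (2 * h) < a → Gap a (suc (2 * h))
  a+4          : Gap a (a + 4)
  beyond-reach : ∀ i t → 4 * i < t → t < a → Gap a (i * a + 2 * t)

a+4-canonical : ∀ a → 1 * a + 2 * 2 ≡ a + 4
a+4-canonical a = solve (a ∷ [])

Gap⇒∉S : ∀ {a x} → Odd a → 2 < a → Gap a x → ¬ S a x
Gap⇒∉S _ _ (odd-below _ x<a) x∈ = <⇒≱ x<a (∈S⇒a≤ x∈ λ ())
Gap⇒∉S {a} a-odd 2<a a+4 x∈ with ∈S⇒admissible x∈
... | i , t , (t≤ , not-1,2) , eq with coefficient-bound a-odd 1 2 i t 2<a (trans (a+4-canonical a) eq)
...   | z≤n with z≤n ← t≤ = m+1+n≢0 a eq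
...   | s≤s z≤n = not-1,2 (refl , sym (*-cancelˡ-≡ 2 t 2 (+-cancelˡ-≡ (1 * a) _ _ (trans (a+4-canonical a) eq))))
Gap⇒∉S {a} a-odd _ (beyond-reach i t 4i<t t<a) x∈ with ∈S⇒admissible x∈
... | i′ , t′ , (t′≤ , _) , eq = <⇒≱ 4i<t (begin
    t       ≤⟨ *-cancelˡ-≤ 2 (+≡+⇒≤ eq (*-monoˡ-≤ a i′≤i)) ⟩
    t′      ≤⟨ t′≤ ⟩
    4 * i′  ≤⟨ *-monoʳ-≤ 4 i′≤i ⟩
    4 * i   ∎)
  where
  open ≤-Reasoning
  i′≤i : i′ ≤ i
  i′≤i = coefficient-bound a-odd i t i′ t′ t<a eq

canonical-∈S⊎Gap : ∀ {a} i t → t < a → S a (i * a + 2 * t) ⊎ Gap a (i * a + 2 * t)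
canonical-∈S⊎Gap {a} i t t<a with t ≤? 4 * i | i ≟ 1 ×-dec t ≟ 2
... | no t≰4i  | _                 = inj₂ (beyond-reach i t (≰⇒> t≰4i) t<a)
... | yes _    | yes (refl , refl) = inj₂ (subst (Gap a) (sym (a+4-canonical a)) a+4)
... | yes t≤4i | no not-1,2        = inj₁ (admissible⇒∈S i t (t≤4i , not-1,2))

∈S⊎Gap : ∀ {a} → Odd a → ∀ x → S a x ⊎ Gap a x
∈S⊎Gap {a} (odd m) x =
  subst (λ y → S a y ⊎ Gap a y) (sym (m≡m%n+[m/n]*n x a)) (by-remainder (x % a) (x / a) (m%n<n x a))
  where
  by-remainder : ∀ r q → r < a → S a (r + q * a) ⊎ Gap a (r + q * a)
  by-remainder r q r<a with even-or-odd r
  ... | h , inj₁ refl =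
    subst (λ y → S a y ⊎ Gap a y) (+-comm (q * a) (2 * h)) (canonical-∈S⊎Gap q h (≤-<-trans (m≤n*m h 2) r<a))
  ... | h , inj₂ refl = odd-remainder h q r<a
    where
    -- an odd remainder borrows one a, turning r + (q + 1)·a into q·a + (a + r)
    odd-remainder : ∀ h q → suc (2 * h) < a → S a (suc (2 * h) + q * a) ⊎ Gap a (suc (2 * h) + q * a)
    odd-remainder h zero r<a = inj₂ (subst (Gap a) (sym (+-identityʳ _)) (odd-below h r<a))
    odd-remainder h (suc q) r<a =
      subst (λ y → S a y ⊎ Gap a y) carry (canonical-∈S⊎Gap q (suc (m + h)) (s≤s m+h<2m))
      where
      carry : q * a + 2 * suc (m + h) ≡ suc (2 * h) + suc q * a
      carry = solve (m ∷ h ∷ q ∷ [])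
      m+m≡2m : m + m ≡ 2 * m
      m+m≡2m = solve (m ∷ [])
      m+h<2m : m + h < 2 * m
      m+h<2m = subst (m + h <_) m+m≡2m (+-monoʳ-< m (*-cancelˡ-< 2 h m (≤-pred r<a)))

∉S⇒Gap : ∀ {a x} → Odd a → ¬ S a x → Gap a x
∉S⇒Gap {x = x} a-odd x∉ with ∈S⊎Gap a-odd x
... | inj₁ x∈  = ⊥-elim (x∉ x∈)
... | inj₂ gap = gap

odd-below≢a+4 : ∀ {a} h → suc (2 * h) < a → suc (2 * h) ≢ a + 4
odd-below≢a+4 {a} h x<a = <⇒≢ (<-≤-trans x<a (m≤m+n a 4))

odd-below≢canonical : ∀ {a} h i t → suc (2 * h) < a → suc (2 * h) ≢ i * a + 2 * t
odd-below≢canonical h zero t _ eq = even≢odd t h (sym eq)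
odd-below≢canonical {a} h (suc i) t x<a eq =
  <⇒≱ x<a (≤-offset (i * a + 2 * t) (sym (trans eq (+-assoc a (i * a) (2 * t)))))

a+4≢beyond-reach : ∀ {a} → Odd a → 2 < a → ∀ i t → 4 * i < t → t < a → a + 4 ≢ i * a + 2 * t
a+4≢beyond-reach {a} a-odd 2<a i t 4i<t t<a eq
  with refl , refl ← canonical-unique a-odd {1} {2} {i} {t} 2<a t<a (trans (a+4-canonical a) eq) =
  <⇒≱ 4i<t (≤ᵇ⇒≤ 2 4 _)

PF+generator≢Gap : ∀ {a x d y} → Odd a → 2 < a → PF (S a) x → d ∈ offsets → Gap a y → x + (a + 2 * d) ≢ y
PF+generator≢Gap {a} a-odd 2<a pf d∈ gap eq =
  Gap⇒∉S a-odd 2<a gap (subst (S a) eq (PF⇒+generator (<-trans (s≤s z≤n) 2<a) pf d∈))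

-- Rows of gaps

row : ℕ → ℕ → ℕ → List ℕ
row a i n = applyUpTo (λ e → i * a + 2 * suc (4 * i + e)) n

∈-row⁺ : ∀ a i n {t} → 4 * i < t → t ≤ 4 * i + n → i * a + 2 * t ∈ row a i n
∈-row⁺ a i n 4i<t t≤ with e , refl ← m≤n⇒∃[o]m+o≡n 4i<t =
  ∈-applyUpTo⁺ (λ e → i * a + 2 * suc (4 * i + e))
    (+-cancelˡ-≤ (4 * i) _ _ (subst (_≤ 4 * i + n) (sym (+-suc (4 * i) e)) t≤))

∈-row⁻ : ∀ a i n {x} → x ∈ row a i n → Σ ℕ λ t → 4 * i < t × t ≤ 4 * i + n × x ≡ i * a + 2 * t
∈-row⁻ a i n x∈ with e , e<n , refl ← ∈-applyUpTo⁻ (λ e → i * a + 2 * suc (4 * i + e)) x∈ =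
  suc (4 * i + e) , s≤s (m≤m+n _ e) , subst (_≤ 4 * i + n) (+-suc (4 * i) e) (+-monoʳ-≤ (4 * i) e<n) , refl

length-row : ∀ a i n → length (row a i n) ≡ n
length-row a i = length-applyUpTo (λ e → i * a + 2 * suc (4 * i + e))

row-unique : ∀ a i n → Unique (row a i n)
row-unique a i n = applyUpTo⁺₁ _ n λ e<e′ _ → <⇒≢ (+-monoʳ-< (i * a) (*-monoʳ-< 2 (s≤s (+-monoʳ-< (4 * i) e<e′))))

rows : ℕ → ℕ → ℕ → List ℕ
rows a j zero    = row a j 2
rows a j (suc r) = row a j (4 * suc r + 2) ++ rows a (suc j) r

row-bound : ∀ j r → 4 * j + (4 * r + 2) ≡ 4 * (j + r) + 2
row-bound j r = solve (j ∷ r ∷ [])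

next-row-bound : ∀ j r → 4 * (suc j + r) + 2 ≡ 4 * (j + suc r) + 2
next-row-bound j r = cong (λ n → 4 * n + 2) (sym (+-suc j r))

∈-rows⁺ : ∀ a j r {i t} → j ≤ i → 4 * i < t → t ≤ 4 * (j + r) + 2 → i * a + 2 * t ∈ rows a j r
∈-rows⁺ a j r {i} j≤i 4i<t t≤ with j ≟ i
∈-rows⁺ a j zero {t = t} _ 4i<t t≤ | yes refl = ∈-row⁺ a j 2 4i<t (subst (t ≤_) (sym (row-bound j 0)) t≤)
∈-rows⁺ a j (suc r) {t = t} _ 4i<t t≤ | yes refl =
  ∈-++⁺ˡ (∈-row⁺ a j _ 4i<t (subst (t ≤_) (sym (row-bound j (suc r))) t≤))
∈-rows⁺ a j zero {i} {t} j≤i 4i<t t≤ | no j≢i = ⊥-elim (<⇒≱ 4i<t (begin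
  t                ≤⟨ t≤ ⟩
  4 * (j + 0) + 2  ≤⟨ ≤-offset 2 (solve (j ∷ [])) ⟩
  4 * suc j        ≤⟨ *-monoʳ-≤ 4 (≤∧≢⇒< j≤i j≢i) ⟩
  4 * i            ∎))
  where open ≤-Reasoning
∈-rows⁺ a j (suc r) {t = t} j≤i 4i<t t≤ | no j≢i =
  ∈-++⁺ʳ _ (∈-rows⁺ a (suc j) r (≤∧≢⇒< j≤i j≢i) 4i<t (subst (t ≤_) (sym (next-row-bound j r)) t≤))

∈-rows⁻ : ∀ a j r {x} → x ∈ rows a j r →
  Σ ℕ λ i → Σ ℕ λ t → j ≤ i × 4 * i < t × t ≤ 4 * (j + r) + 2 × x ≡ i * a + 2 * t
∈-rows⁻ a j zero x∈ with t , 4j<t , t≤ , refl ← ∈-row⁻ a j 2 x∈ =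
  j , t , ≤-refl , 4j<t , subst (t ≤_) (row-bound j 0) t≤ , refl
∈-rows⁻ a j (suc r) x∈ with ∈-++⁻ (row a j (4 * suc r + 2)) x∈
... | inj₁ x∈row with t , 4j<t , t≤ , refl ← ∈-row⁻ a j _ x∈row =
  j , t , ≤-refl , 4j<t , subst (t ≤_) (row-bound j (suc r)) t≤ , refl
... | inj₂ x∈rows with i , t , j<i , 4i<t , t≤ , refl ← ∈-rows⁻ a (suc j) r x∈rows =
  i , t , <⇒≤ j<i , 4i<t , subst (t ≤_) (next-row-bound j r) t≤ , refl

length-rows : ∀ a j r → length (rows a j r) ≡ 2 * suc r * suc r
length-rows a j zero = length-row a j 2
length-rows a j (suc r) = begin
  length (row a j (4 * suc r + 2) ++ rows a (suc j) r)
    ≡⟨ length-++ (row a j (4 * suc r + 2)) ⟩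
  length (row a j (4 * suc r + 2)) + length (rows a (suc j) r)
    ≡⟨ cong₂ _+_ (length-row a j (4 * suc r + 2)) (length-rows a (suc j) r) ⟩
  4 * suc r + 2 + 2 * suc r * suc r
    ≡⟨ solve (r ∷ []) ⟩
  2 * suc (suc r) * suc (suc r) ∎
  where open ≡-Reasoning

rows-unique : ∀ {a} → Odd a → ∀ j r → 4 * (j + r) + 2 < a → Unique (rows a j r)
rows-unique {a} _ j zero _ = row-unique a j 2
rows-unique {a} a-odd j (suc r) top<a =
  ++⁺ (row-unique a j (4 * suc r + 2)) (rows-unique a-odd (suc j) r (subst (_< a) (sym (next-row-bound j r)) top<a))
      disjoint
  where
  disjoint : ∀ {v} → ¬ (v ∈ row a j (4 * suc r + 2) × v ∈ rows a (suc j) r)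
  disjoint (v∈row , v∈rows)
    with t , _ , t≤ , refl ← ∈-row⁻ a j _ v∈row
       | i , t′ , j<i , _ , t′≤ , eq ← ∈-rows⁻ a (suc j) r v∈rows =
    <⇒≢ j<i (proj₁ (canonical-unique a-odd t<a t′<a eq))
    where
    t<a : t < a
    t<a = ≤-<-trans (subst (t ≤_) (row-bound j (suc r)) t≤) top<a
    t′<a : t′ < a
    t′<a = ≤-<-trans (subst (t′ ≤_) (next-row-bound j r) t′≤) top<a

-- The semigroup ⟨4k + 7, 4k + 9, 4k + 13, 4k + 15⟩

4k+7≡1+2[2k+3] : ∀ k → 4 * k + 7 ≡ suc (2 * (2 * k + 3))
4k+7≡1+2[2k+3] k = solve (k ∷ [])

4k+7-odd : ∀ k → Odd (4 * k + 7)
4k+7-odd k = subst Odd (sym (4k+7≡1+2[2k+3] k)) (odd (2 * k + 3))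

2<4k+7 : ∀ k → 2 < 4 * k + 7
2<4k+7 k = ≤-trans (≤ᵇ⇒≤ 3 7 _) (m≤n+m 7 (4 * k))

odd<4k+7⇔ : ∀ k h → suc (2 * h) < 4 * k + 7 ⇔ h < 2 * k + 3
odd<4k+7⇔ k h = mk⇔
  (λ lt → *-cancelˡ-< 2 h (2 * k + 3) (≤-pred (subst (suc (suc (2 * h)) ≤_) (4k+7≡1+2[2k+3] k) lt)))
  (λ lt → subst (suc (suc (2 * h)) ≤_) (sym (4k+7≡1+2[2k+3] k)) (s≤s (*-monoʳ-< 2 lt)))

<4k+7⇔ : ∀ k t → t < 4 * k + 7 ⇔ t ≤ 4 * suc k + 2
<4k+7⇔ k t = mk⇔ (λ lt → ≤-pred (subst (suc t ≤_) top lt)) (λ le → subst (suc t ≤_) (sym top) (s≤s le))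
  where
  top : 4 * k + 7 ≡ suc (4 * suc k + 2)
  top = solve (k ∷ [])

gaps : ℕ → List ℕ
gaps k = applyUpTo (λ h → suc (2 * h)) (2 * k + 3) ++ 4 * k + 7 + 4 ∷ rows (4 * k + 7) 0 (suc k)

∈gaps⇔Gap : ∀ k x → x ∈ gaps k ⇔ Gap (4 * k + 7) x
∈gaps⇔Gap k x = mk⇔ to from
  where
  to : x ∈ gaps k → Gap (4 * k + 7) x
  to x∈ with ∈-++⁻ (applyUpTo (λ h → suc (2 * h)) (2 * k + 3)) x∈
  ... | inj₁ p with h , h< , refl ← ∈-applyUpTo⁻ (λ h → suc (2 * h)) p =
    odd-below h (Equivalence.from (odd<4k+7⇔ k h) h<)
  ... | inj₂ (here refl) = a+4
  ... | inj₂ (there p) with i , t , _ , 4i<t , t≤ , refl ← ∈-rows⁻ (4 * k + 7) 0 (suc k) p =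
    beyond-reach i t 4i<t (Equivalence.from (<4k+7⇔ k t) t≤)
  from : Gap (4 * k + 7) x → x ∈ gaps k
  from (odd-below h lt) = ∈-++⁺ˡ (∈-applyUpTo⁺ (λ h → suc (2 * h)) (Equivalence.to (odd<4k+7⇔ k h) lt))
  from a+4 = ∈-++⁺ʳ _ (here refl)
  from (beyond-reach i t 4i<t t<a) =
    ∈-++⁺ʳ _ (there (∈-rows⁺ (4 * k + 7) 0 (suc k) {i} {t} z≤n 4i<t (Equivalence.to (<4k+7⇔ k t) t<a)))

gaps-unique : ∀ k → Unique (gaps k)
gaps-unique k = ++⁺ odds-unique (a+4∉rows AllPairs.∷ rows-unique (4k+7-odd k) 0 (suc k) top<a) disjoint
  where
  odds : List ℕ
  odds = applyUpTo (λ h → suc (2 * h)) (2 * k + 3)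
  odds-unique : Unique odds
  odds-unique = applyUpTo⁺₁ _ _ λ h<h′ _ → <⇒≢ (s≤s (*-monoʳ-< 2 h<h′))
  top<a : 4 * suc k + 2 < 4 * k + 7
  top<a = Equivalence.from (<4k+7⇔ k _) ≤-refl
  a+4∉rows : All.All (4 * k + 7 + 4 ≢_) (rows (4 * k + 7) 0 (suc k))
  a+4∉rows = ¬Any⇒All¬ _ λ p →
    let i , t , _ , 4i<t , t≤ , eq = ∈-rows⁻ (4 * k + 7) 0 (suc k) p
    in a+4≢beyond-reach (4k+7-odd k) (2<4k+7 k) i t 4i<t (Equivalence.from (<4k+7⇔ k t) t≤) eq
  disjoint : ∀ {v} → ¬ (v ∈ odds × v ∈ 4 * k + 7 + 4 ∷ rows (4 * k + 7) 0 (suc k))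
  disjoint (p , here eq) with h , h< , refl ← ∈-applyUpTo⁻ (λ h → suc (2 * h)) p =
    odd-below≢a+4 h (Equivalence.from (odd<4k+7⇔ k h) h<) eq
  disjoint (p , there q)
    with h , h< , refl ← ∈-applyUpTo⁻ (λ h → suc (2 * h)) p
       | i , t , _ , _ , _ , eq ← ∈-rows⁻ (4 * k + 7) 0 (suc k) q =
    odd-below≢canonical h i t (Equivalence.from (odd<4k+7⇔ k h) h<) eq

length-gaps : ∀ k → length (gaps k) ≡ 2 * k * k + 10 * k + 12
length-gaps k = begin
  length (odds ++ 4 * k + 7 + 4 ∷ rows (4 * k + 7) 0 (suc k))
    ≡⟨ length-++ odds ⟩
  length odds + suc (length (rows (4 * k + 7) 0 (suc k)))
    ≡⟨ cong₂ _+_ (length-applyUpTo _ (2 * k + 3)) (cong suc (length-rows (4 * k + 7) 0 (suc k))) ⟩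
  2 * k + 3 + suc (2 * suc (suc k) * suc (suc k))
    ≡⟨ solve (k ∷ []) ⟩
  2 * k * k + 10 * k + 12 ∎
  where
  open ≡-Reasoning
  odds : List ℕ
  odds = applyUpTo (λ h → suc (2 * h)) (2 * k + 3)

genus : ∀ k → IsGenus (S (4 * k + 7)) (2 * k * k + 10 * k + 12)
genus k = gaps k , gaps-unique k , ∈gaps⇔∉S , length-gaps k
  where
  ∈gaps⇔∉S : ∀ x → x ∈ gaps k ⇔ (¬ S (4 * k + 7) x)
  ∈gaps⇔∉S x = mk⇔ (λ x∈ → Gap⇒∉S (4k+7-odd k) (2<4k+7 k) (Equivalence.to (∈gaps⇔Gap k x) x∈))
                   (λ x∉ → Equivalence.from (∈gaps⇔Gap k x) (∉S⇒Gap (4k+7-odd k) x∉))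

F-canonical : ∀ k → suc k * (4 * k + 7) + 2 * (4 * suc k + 2) ≡ 4 * k * k + 19 * k + 19
F-canonical k = solve (k ∷ [])

F-2-canonical : ∀ k → suc k * (4 * k + 7) + 2 * (4 * suc k + 1) ≡ 4 * k * k + 19 * k + 17
F-2-canonical k = solve (k ∷ [])

Gap-F : ∀ k → Gap (4 * k + 7) (4 * k * k + 19 * k + 19)
Gap-F k = subst (Gap (4 * k + 7)) (F-canonical k)
  (beyond-reach (suc k) (4 * suc k + 2) (m<m+n (4 * suc k) (s≤s z≤n)) (Equivalence.from (<4k+7⇔ k _) ≤-refl))

Gap-F-2 : ∀ k → Gap (4 * k + 7) (4 * k * k + 19 * k + 17)
Gap-F-2 k = subst (Gap (4 * k + 7)) (F-2-canonical k)
  (beyond-reach (suc k) (4 * suc k + 1) (m<m+n (4 * suc k) (s≤s z≤n))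
    (Equivalence.from (<4k+7⇔ k _) (+-monoʳ-≤ (4 * suc k) (n≤1+n 1))))

Gap⇒≤F : ∀ k {x} → Gap (4 * k + 7) x → x ≤ 4 * k * k + 19 * k + 19
Gap⇒≤F k (odd-below _ x<a) = ≤-trans (<⇒≤ x<a) (≤-offset (4 * k * k + 15 * k + 12) (solve (k ∷ [])))
Gap⇒≤F k a+4 = ≤-offset (4 * k * k + 15 * k + 8) (solve (k ∷ []))
Gap⇒≤F k (beyond-reach i t 4i<t t<a) = begin
  i * (4 * k + 7) + 2 * t                   ≤⟨ +-mono-≤ (*-monoˡ-≤ (4 * k + 7) i≤1+k) (*-monoʳ-≤ 2 t≤) ⟩
  suc k * (4 * k + 7) + 2 * (4 * suc k + 2) ≡⟨ F-canonical k ⟩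
  4 * k * k + 19 * k + 19                   ∎
  where
  open ≤-Reasoning
  t≤ : t ≤ 4 * suc k + 2
  t≤ = Equivalence.to (<4k+7⇔ k t) t<a
  next-row : 4 * suc k + 2 + 2 ≡ 4 * suc (suc k)
  next-row = solve (k ∷ [])
  i≤1+k : i ≤ suc k
  i≤1+k = ≤-pred (*-cancelˡ-< 4 i (suc (suc k)) (<-≤-trans 4i<t (≤-trans t≤ (≤-offset 2 next-row))))

frobenius : ∀ k → IsFrobenius (S (4 * k + 7)) (4 * k * k + 19 * k + 19)
frobenius k = Gap⇒∉S (4k+7-odd k) (2<4k+7 k) (Gap-F k) , above
  where
  above : ∀ y → 4 * k * k + 19 * k + 19 < y → S (4 * k + 7) y
  above y F<y with ∈S⊎Gap (4k+7-odd k) y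
  ... | inj₁ y∈  = y∈
  ... | inj₂ gap = ⊥-elim (<⇒≱ F<y (Gap⇒≤F k gap))

last-rows : ∀ k i e → e < 4 → 4 * k + 2 ≤ 4 * i + e → 4 * i + e ≤ 4 * k + 5 →
  (i ≡ k × e ≡ 2) ⊎ (i ≡ k × e ≡ 3) ⊎ (i ≡ suc k × e ≡ 0) ⊎ (i ≡ suc k × e ≡ 1)
last-rows k i e e<4 lower upper with d , 4k+2+d≡ ← m≤n⇒∃[o]m+o≡n lower = by-offset d d≤3 quotient
  where
  quotient : 4 * i + e ≡ 4 * k + (2 + d)
  quotient = trans (sym 4k+2+d≡) (+-assoc (4 * k) 2 d)
  d≤3 : d ≤ 3
  d≤3 = +-cancelˡ-≤ (4 * k + 2) d 3
          (subst (4 * k + 2 + d ≤_) (sym (+-assoc (4 * k) 2 3)) (subst (_≤ 4 * k + 5) (sym 4k+2+d≡) upper))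
  next-quotient : ∀ r → 4 * k + (4 + r) ≡ 4 * suc k + r
  next-quotient r = solve (k ∷ r ∷ [])
  by-offset : ∀ d → d ≤ 3 → 4 * i + e ≡ 4 * k + (2 + d) →
    (i ≡ k × e ≡ 2) ⊎ (i ≡ k × e ≡ 3) ⊎ (i ≡ suc k × e ≡ 0) ⊎ (i ≡ suc k × e ≡ 1)
  by-offset 0 _ q = inj₁ (division-unique 4 e<4 (≤ᵇ⇒≤ 3 4 _) q)
  by-offset 1 _ q = inj₂ (inj₁ (division-unique 4 e<4 ≤-refl q))
  by-offset 2 _ q = inj₂ (inj₂ (inj₁ (division-unique 4 e<4 (s≤s z≤n) (trans q (next-quotient 0)))))
  by-offset 3 _ q = inj₂ (inj₂ (inj₂ (division-unique 4 e<4 (≤ᵇ⇒≤ 2 4 _) (trans q (next-quotient 1)))))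
  by-offset (suc (suc (suc (suc _)))) (s≤s (s≤s (s≤s ()))) _

-- For (i, e) = (k, 2) and (k, 3), adding a + 6 resp. a + 2 reaches the gaps F resp. F − 2.
PF-last-rows : ∀ k i e → e < 4 → 4 * k + 2 ≤ 4 * i + e → 4 * i + e ≤ 4 * k + 5 →
  let x = i * (4 * k + 7) + 2 * suc (4 * i + e) in
  PF (S (4 * k + 7)) x → x ≡ 4 * k * k + 19 * k + 17 ⊎ x ≡ 4 * k * k + 19 * k + 19
PF-last-rows k i e e<4 lower upper pf with last-rows k i e e<4 lower upper
... | inj₁ (refl , refl) =
  ⊥-elim (PF+generator≢Gap (4k+7-odd k) (2<4k+7 k) pf (there (there (here refl))) (Gap-F k) (solve (k ∷ [])))
... | inj₂ (inj₁ (refl , refl)) =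
  ⊥-elim (PF+generator≢Gap (4k+7-odd k) (2<4k+7 k) pf (there (here refl)) (Gap-F-2 k) (solve (k ∷ [])))
... | inj₂ (inj₂ (inj₁ (refl , refl))) = inj₁ (solve (k ∷ []))
... | inj₂ (inj₂ (inj₂ (refl , refl))) = inj₂ (solve (k ∷ []))

-- x + a and x + (a + 8) are gaps of row i + 1 unless t is within 4 of both 4 * i and a.
PF-beyond-reach : ∀ k i t → 4 * i < t → t < 4 * k + 7 → PF (S (4 * k + 7)) (i * (4 * k + 7) + 2 * t) →
  i * (4 * k + 7) + 2 * t ≡ 4 * k * k + 19 * k + 17 ⊎ i * (4 * k + 7) + 2 * t ≡ 4 * k * k + 19 * k + 19
PF-beyond-reach k i t 4i<t t<a pf with 4 * suc i <? t | t + 4 <? 4 * k + 7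
... | yes 4[i+1]<t | _ =
  ⊥-elim (PF+generator≢Gap (4k+7-odd k) (2<4k+7 k) pf (here refl)
    (beyond-reach (suc i) t 4[i+1]<t t<a) (solve (i ∷ t ∷ k ∷ [])))
... | no _ | yes t+4<a =
  ⊥-elim (PF+generator≢Gap (4k+7-odd k) (2<4k+7 k) pf (there (there (there (here refl))))
    (beyond-reach (suc i) (t + 4) 4[i+1]<t+4 t+4<a) (solve (i ∷ t ∷ k ∷ [])))
  where
  4[i+1]<t+4 : 4 * suc i < t + 4
  4[i+1]<t+4 = subst (_< t + 4) (trans (+-comm (4 * i) 4) (sym (*-suc 4 i))) (+-monoˡ-< 4 4i<t)
... | no t≮ | no t+4≮ with e , refl ← m≤n⇒∃[o]m+o≡n 4i<t = PF-last-rows k i e e<4 lower upper pf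
  where
  e<4 : e < 4
  e<4 = +-cancelˡ-≤ (4 * i) (suc e) 4
          (subst₂ _≤_ (sym (+-suc (4 * i) e)) (trans (*-suc 4 i) (+-comm 4 (4 * i))) (≮⇒≥ t≮))
  a≡[4k+2]+5 : 4 * k + 7 ≡ 4 * k + 2 + 5
  a≡[4k+2]+5 = solve (k ∷ [])
  t+4≡[4i+e]+5 : suc (4 * i + e) + 4 ≡ 4 * i + e + 5
  t+4≡[4i+e]+5 = solve (i ∷ e ∷ [])
  lower : 4 * k + 2 ≤ 4 * i + e
  lower = +-cancelʳ-≤ 5 (4 * k + 2) (4 * i + e) (subst₂ _≤_ a≡[4k+2]+5 t+4≡[4i+e]+5 (≮⇒≥ t+4≮))
  a≡2+[4k+5] : 4 * k + 7 ≡ suc (suc (4 * k + 5))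
  a≡2+[4k+5] = solve (k ∷ [])
  upper : 4 * i + e ≤ 4 * k + 5
  upper = ≤-pred (≤-pred (subst (suc (suc (4 * i + e)) ≤_) a≡2+[4k+5] t<a))

PF⇒ : ∀ k {x} → PF (S (4 * k + 7)) x →
  x ≡ 4 * k + 11 ⊎ x ≡ 4 * k * k + 19 * k + 17 ⊎ x ≡ 4 * k * k + 19 * k + 19
PF⇒ k pf@(x∉ , _) with ∉S⇒Gap (4k+7-odd k) x∉
... | odd-below h x<a =
  ⊥-elim (PF+generator≢Gap (4k+7-odd k) (2<4k+7 k) pf (here refl)
    (beyond-reach 0 (suc (2 * k + 3 + h)) (s≤s z≤n) (Equivalence.from (<4k+7⇔ k _) bound)) (solve (k ∷ h ∷ [])))
  where
  twice : 2 * k + 3 + (2 * k + 3) ≡ 4 * suc k + 2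
  twice = solve (k ∷ [])
  bound : suc (2 * k + 3 + h) ≤ 4 * suc k + 2
  bound = subst (suc (2 * k + 3 + h) ≤_) twice (+-monoʳ-< (2 * k + 3) (Equivalence.to (odd<4k+7⇔ k h) x<a))
... | a+4 = inj₁ (solve (k ∷ []))
... | beyond-reach i t 4i<t t<a = inj₂ (PF-beyond-reach k i t 4i<t t<a pf)

PF⇐ : ∀ k {x} → x ≡ 4 * k + 11 ⊎ x ≡ 4 * k * k + 19 * k + 17 ⊎ x ≡ 4 * k * k + 19 * k + 19 →
  PF (S (4 * k + 7)) x
PF⇐ k (inj₁ refl) = subst (PF (S (4 * k + 7))) a+4≡
  (Gap⇒∉S (4k+7-odd k) (2<4k+7 k) a+4 , λ _ s∈ s≢0 → a+4+∈S s∈ s≢0)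
  where
  a+4≡ : 4 * k + 7 + 4 ≡ 4 * k + 11
  a+4≡ = solve (k ∷ [])
PF⇐ k (inj₂ (inj₁ refl)) = large-gap⇒PF (frobenius k) (λ _ → ∈S⇒a≤)
  (≤-offset (4 * k + 4) beyond-F) (Gap⇒∉S (4k+7-odd k) (2<4k+7 k) (Gap-F-2 k))
  where
  beyond-F : suc (4 * k * k + 19 * k + 19) + (4 * k + 4) ≡ 4 * k * k + 19 * k + 17 + (4 * k + 7)
  beyond-F = solve (k ∷ [])
PF⇐ k (inj₂ (inj₂ refl)) = large-gap⇒PF (frobenius k) (λ _ → ∈S⇒a≤)
  (≤-offset (4 * k + 6) beyond-F) (Gap⇒∉S (4k+7-odd k) (2<4k+7 k) (Gap-F k))
  where
  beyond-F : suc (4 * k * k + 19 * k + 19) + (4 * k + 6) ≡ 4 * k * k + 19 * k + 19 + (4 * k + 7)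
  beyond-F = solve (k ∷ [])

PF⇔ : ∀ k x → PF (S (4 * k + 7)) x ⇔
  (x ≡ 4 * k + 11 ⊎ x ≡ 4 * k * k + 19 * k + 17 ⊎ x ≡ 4 * k * k + 19 * k + 19)
PF⇔ k x = mk⇔ (PF⇒ k) (PF⇐ k)

type : ∀ k → IsType (S (4 * k + 7)) 3
type k = 4 * k + 11 ∷ 4 * k * k + 19 * k + 17 ∷ 4 * k * k + 19 * k + 19 ∷ [] , distinct ,
  (λ x → ⇔.trans ∈-triple⇔ (⇔.sym (PF⇔ k x))) , refl
  where
  a+4<F-2 : 4 * k + 11 < 4 * k * k + 19 * k + 17
  a+4<F-2 = ≤-offset (4 * k * k + 15 * k + 5) (solve (k ∷ []))
  F-2<F : 4 * k * k + 19 * k + 17 < 4 * k * k + 19 * k + 19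
  F-2<F = ≤-offset 1 (solve (k ∷ []))
  distinct : Unique (4 * k + 11 ∷ 4 * k * k + 19 * k + 17 ∷ 4 * k * k + 19 * k + 19 ∷ [])
  distinct = (<⇒≢ a+4<F-2 All.∷ <⇒≢ (<-trans a+4<F-2 F-2<F) All.∷ All.[])
    AllPairs.∷ (<⇒≢ F-2<F All.∷ All.[]) AllPairs.∷ All.[] AllPairs.∷ AllPairs.[]

generators-4k+7 : ∀ k → generators (4 * k + 7) ≡ 4 * k + 7 ∷ 4 * k + 9 ∷ 4 * k + 13 ∷ 4 * k + 15 ∷ []
generators-4k+7 k =
  cong₂ _∷_ (+-identityʳ _) (cong₂ _∷_ (solve (k ∷ [])) (cong₂ _∷_ (solve (k ∷ [])) (cong (_∷ []) (solve (k ∷ [])))))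

corollary33 : (k : ℕ) →
    let S = ⟨ (4 * k + 7) ∷ (4 * k + 9) ∷ (4 * k + 13) ∷ (4 * k + 15) ∷ [] ⟩ in
    (∀ x → PF S x ⇔ (x ≡ 4 * k + 11 ⊎ x ≡ 4 * k * k + 19 * k + 17 ⊎ x ≡ 4 * k * k + 19 * k + 19))
    × IsFrobenius S (4 * k * k + 19 * k + 19)
    × IsGenus S (2 * k * k + 10 * k + 12)
    × IsType S 3
corollary33 k =
  transport (λ T → ∀ x → PF T x ⇔ (x ≡ 4 * k + 11 ⊎ x ≡ 4 * k * k + 19 * k + 17 ⊎ x ≡ 4 * k * k + 19 * k + 19))
    (PF⇔ k) ,
  transport (λ T → IsFrobenius T (4 * k * k + 19 * k + 19)) (frobenius k) ,
  transport (λ T → IsGenus T (2 * k * k + 10 * k + 12)) (genus k) ,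
  transport (λ T → IsType T 3) (type k)
  where
  transport : (P : Subset → Set) → P (S (4 * k + 7)) → P ⟨ 4 * k + 7 ∷ 4 * k + 9 ∷ 4 * k + 13 ∷ 4 * k + 15 ∷ [] ⟩
  transport P = subst (λ X → P ⟨ X ⟩) (generators-4k+7 k)
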